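{- Let $n\ge 2$ and let $F$ be the $n$-cell null-boundary non-uniform cellular automaton with rule vector $\langle \mathcal{R}_0,\dots,\mathcal{R}_{n-1}\rangle$. Let $S=(s_0,\dots,s_{n-1})$ and $D=(d_0,\dots,d_{n-1})$ be configurations in $\{0,1\}^n$. For $0\le i\le n-1$ let $\sigma_i=E_{i.a_i}$ and $\delta_i=E_{i.b_i}$ be the level-$i$ edges of the reachability tree whose indices $a_i,b_i$ have binary representations $s_0s_1\cdots s_i$ and $d_0d_1\cdots d_i$ respectively. If for some $i$ with $0\le i\le n-1$ the edge $\sigma_i$ is self linked for two sibling RMTs and $\delta_i\neq\sigma_i$, then $D$ is not reachable from $S$.
   Context: A rule is a map $\{0,1\}^3\to\{0,1\}$. A triple $(a,b,c)\in\{0,1\}^3$ is called a rule min term (RMT) and is identified with the integer $4a+2b+c\in\{0,\dots,7\}$; $\mathcal{R}[r]$ denotes the value of rule $\mathcal{R}$ on RMT $r$. Two RMTs $r\neq s$ are siblings if $\lfloor r/2\rfloor=\lfloor s/2\rfloor$. The $n$-cell null-boundary non-uniform CA with rule vector $\langle \mathcal{R}_0,\dots,\mathcal{R}_{n-1}\rangle$ is the map $F:\{0,1\}^n\to\{0,1\}^n$, $F(x)_i=\mathcal{R}_i[4x_{i-1}+2x_i+x_{i+1}]$ for $0\le i\le n-1$, with the convention $x_{ -1}=x_n=0$. A configuration $D$ is reachable from $S$ if $D=F^t(S)$ for some integer $t\ge 1$. Reachability tree edges, labels and links: for $0\le i\le n-1$ the edges of level $i$ are $E_{i.j}$, $0\le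 j\le 2^{i+1}-1$, where $E_{i.j}$ is identified with the bit string $b_0b_1\cdots b_i$ that is the $(i+1)$-bit binary representation of $j$ ($b_0$ most significant). Call a tuple $(x_0,\dots,x_{i+1})\in\{0,1\}^{i+2}$ (with $x_{i+1}=0$ required when $i=n-1$, and $x_{ -1}:=0$) a witness for $E_{i.j}$ if $\mathcal{R}_m[4x_{m-1}+2x_m+x_{m+1}]=b_m$ for all $0\le m\le i$; its RMT is $r=4x_{i-1}+2x_i+x_{i+1}$. The label $l_{i.j}$ is the set of RMTs of witnesses for $E_{i.j}$. For each witness of $E_{i.j}$ with RMT $r$, there is a link from $E_{i.j}$ to $E_{i.k}$ for RMT $r$, where $k$ is the integer with binary representation $x_0x_1\cdots x_i$. The edge $E_{i.j}$ is self linked for RMT $r$ if there is a link from $E_{i.j}$ to $E_{i.j}$ for RMT $r$; it is self linked for two sibling RMTs if it is self linked for RMT $r$ and for RMT $r'$ where $r,r'$ are siblings. -}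

module Defs where

open import Data.Nat using (ℕ; zero; suc; _≤_; ⌊_/2⌋)
open import Data.Bool using (Bool; true; false)
open import Data.Fin using (Fin; toℕ; inject≤)
open import Data.Fin.Properties using (toℕ<n)
open import Data.Vec using (Vec; []; _∷_; lookup; tabulate; init)
open import Data.Product using (Σ; _×_; ∃; ∃-syntax)
open import Relation.Binary.PropositionalEquality using (_≡_; _≢_)

RMT : Set
RMT = Fin 8

Rule : Set
Rule = RMT → Bool

-- The RMT (a,b,c), identified with 4a+2b+c.
rmt : Bool → Bool → Bool → RMT
rmt false false false = Data.Fin.zero

rmt false false true  = Data.Fin.suc Data.Fin.zero
rmt false true  false = Data.Fin.suc (Data.Fin.suc Data.Fin.zero)
rmt false true  true  = Data.Fin.suc (Data.Fin.suc (Data.Fin.suc Data.Fin.zero))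
rmt true  false false = Data.Fin.suc (Data.Fin.suc (Data.Fin.suc (Data.Fin.suc Data.Fin.zero)))
rmt true  false true  = Data.Fin.suc (Data.Fin.suc (Data.Fin.suc (Data.Fin.suc (Data.Fin.suc Data.Fin.zero))))
rmt true  true  false = Data.Fin.suc (Data.Fin.suc (Data.Fin.suc (Data.Fin.suc (Data.Fin.suc (Data.Fin.suc Data.Fin.zero)))))
rmt true  true  true  = Data.Fin.suc (Data.Fin.suc (Data.Fin.suc (Data.Fin.suc (Data.Fin.suc (Data.Fin.suc (Data.Fin.suc Data.Fin.zero))))))

Siblings : RMT → RMT → Set
Siblings r s = r ≢ s × ⌊ toℕ r /2⌋ ≡ ⌊ toℕ s /2⌋

-- nth x m = x_m, and 0 (false) for positions beyond the vector (null boundary x_n = 0).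
nth : ∀ {k} → Vec Bool k → ℕ → Bool
nth [] _ = false
nth (b ∷ _) zero = b
nth (_ ∷ x) (suc m) = nth x m

-- prev x m = x_{m-1}, with x_{-1} = 0 (null boundary).
prev : ∀ {k} → Vec Bool k → ℕ → Bool
prev x zero = false
prev x (suc m) = nth x m

step : ∀ {n} → (Fin n → Rule) → Vec Bool n → Vec Bool n
step R x = tabulate λ i → R i (rmt (prev x (toℕ i)) (lookup x i) (nth x (suc (toℕ i))))

iterate : ∀ {A : Set} → ℕ → (A → A) → A → A
iterate zero f a = a
iterate (suc t) f a = f (iterate t f a)

Reachable : ∀ {n} → (Fin n → Rule) → Vec Bool n → Vec Bool n → Set
Reachable R S D = ∃[ t ] (1 ≤ t × iterate t (step R) S ≡ D)

-- Edges of level i (i : Fin n) are identified with bit strings b_0 … b_i.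
Edge : ∀ {n} → Fin n → Set
Edge i = Vec Bool (suc (toℕ i))

prefix : ∀ {n} → Vec Bool n → (i : Fin n) → Edge i
prefix S i = tabulate λ m → lookup S (inject≤ m (toℕ<n i))

IsWitness : ∀ {n} → (Fin n → Rule) → (i : Fin n) → Edge i → Vec Bool (suc (suc (toℕ i))) → Set
IsWitness {n} R i b x =
  ((m : Fin (suc (toℕ i))) →
     R (inject≤ m (toℕ<n i)) (rmt (prev x (toℕ m)) (nth x (toℕ m)) (nth x (suc (toℕ m))))
       ≡ lookup b m)
  × (suc (toℕ i) ≡ n → nth x (suc (toℕ i)) ≡ false)

witnessRMT : ∀ {n} (i : Fin n) → Vec Bool (suc (suc (toℕ i))) → RMT
witnessRMT i x = rmt (prev x (toℕ i)) (nth x (toℕ i)) (nth x (suc (toℕ i)))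

Link : ∀ {n} → (Fin n → Rule) → (i : Fin n) → Edge i → Edge i → RMT → Set
Link R i b k r = Σ (Vec Bool (suc (suc (toℕ i)))) λ x →
  IsWitness R i b x × witnessRMT i x ≡ r × init x ≡ k

SelfLinked : ∀ {n} → (Fin n → Rule) → (i : Fin n) → Edge i → RMT → Set
SelfLinked R i b r = Link R i b b r

SelfLinkedSiblings : ∀ {n} → (Fin n → Rule) → (i : Fin n) → Edge i → Set
SelfLinkedSiblings R i b = ∃[ r ] ∃[ r' ] (Siblings r r' × SelfLinked R i b r × SelfLinked R i b r')

-- A self-link of an edge b of level i is a witness x = x₀ … x_{i+1} extending b itself, so two
-- self-links share x_{i-1} x_i; if their RMTs differ, they differ in x_{i+1}, and b therefore has
-- self-linking witnesses ending in either bit.  Whatever x_{i+1} a configuration T with prefix b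
-- has, one of them agrees with T on cells 0 … i+1, and F(T) then has prefix b again.  Hence every
-- configuration reachable from S has the same level-i prefix as S.
module Submission where

open import Defs
open import Data.Nat using (ℕ; zero; suc; _≤_; _<_; z≤n; s≤s)
open import Data.Nat.Properties using (<-trans; <⇒≤; n<1+n; m≤n⇒m<n∨m≡n)
open import Data.Bool using (Bool; true; false)
open import Data.Fin using (Fin; toℕ; fromℕ<; inject≤)
open import Data.Fin.Properties using (toℕ<n; toℕ-fromℕ<; toℕ-inject≤)
open import Data.Vec using (Vec; []; _∷_; lookup; init)
open import Data.Vec.Properties using (lookup∘tabulate)
open import Data.Product using (Σ; _×_; _,_)
open import Data.Sum using (_⊎_; inj₁; inj₂)
open import Relation.Nullary using (¬_; contradiction)
open import Function using (_∘_)
open import Relation.Binary.PropositionalEquality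

Agree : ∀ {a b} → ℕ → Vec Bool a → Vec Bool b → Set
Agree k T U = ∀ m → m < k → nth T m ≡ nth U m

Agree-snoc : ∀ {a b k} (T : Vec Bool a) (U : Vec Bool b)
  → Agree k T U → nth T k ≡ nth U k → Agree (suc k) T U
Agree-snoc T U T≈U eq m p with m≤n⇒m<n∨m≡n p
... | inj₁ (s≤s m<k) = T≈U m m<k
... | inj₂ refl      = eq

Agree-fromFin : ∀ {a b k} (T : Vec Bool a) (U : Vec Bool b)
  → (∀ (j : Fin k) → nth T (toℕ j) ≡ nth U (toℕ j)) → Agree k T U
Agree-fromFin T U f m p = subst (λ z → nth T z ≡ nth U z) (toℕ-fromℕ< p) (f (fromℕ< p))

Agree⇒≡ : ∀ {k} (u v : Vec Bool k) → Agree k u v → u ≡ v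
Agree⇒≡ []      []      _   = refl
Agree⇒≡ (a ∷ u) (b ∷ v) u≈v =
  cong₂ _∷_ (u≈v zero (s≤s z≤n)) (Agree⇒≡ u v λ m p → u≈v (suc m) (s≤s p))

nth-lookup : ∀ {k} (x : Vec Bool k) (j : Fin k) → nth x (toℕ j) ≡ lookup x j
nth-lookup (a ∷ x) Fin.zero    = refl
nth-lookup (a ∷ x) (Fin.suc j) = nth-lookup x j

init-Agree : ∀ {k} (x : Vec Bool (suc k)) → Agree k (init x) x
init-Agree {suc k} (a ∷ x) zero    _       = refl
init-Agree {suc k} (a ∷ x) (suc m) (s≤s p) = init-Agree x m p

init≡⇒Agree : ∀ {k} (x : Vec Bool (suc k)) {b : Vec Bool k} → init x ≡ b → Agree k x b
init≡⇒Agree x refl m p = sym (init-Agree x m p)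

prefix-Agree : ∀ {n} (S : Vec Bool n) (i : Fin n) → Agree (suc (toℕ i)) (prefix S i) S
prefix-Agree S i = Agree-fromFin (prefix S i) S λ j → begin
  nth (prefix S i) (toℕ j)        ≡⟨ nth-lookup (prefix S i) j ⟩
  lookup (prefix S i) j           ≡⟨ lookup∘tabulate (λ j → lookup S (inject≤ j (toℕ<n i))) j ⟩
  lookup S (inject≤ j (toℕ<n i))  ≡⟨ nth-lookup S _ ⟨
  nth S (toℕ (inject≤ j _))       ≡⟨ cong (nth S) (toℕ-inject≤ j _) ⟩
  nth S (toℕ j)                   ∎
  where open ≡-Reasoning

prefix≡⇒Agree : ∀ {n} (T S : Vec Bool n) (i : Fin n)
  → prefix T i ≡ prefix S i → Agree (suc (toℕ i)) T S
prefix≡⇒Agree T S i eq m p =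
  trans (sym (prefix-Agree T i m p)) (trans (cong (λ b → nth b m) eq) (prefix-Agree S i m p))

Agree⇒prefix≡ : ∀ {n} (T S : Vec Bool n) (i : Fin n)
  → Agree (suc (toℕ i)) T S → prefix T i ≡ prefix S i
Agree⇒prefix≡ T S i T≈S = Agree⇒≡ (prefix T i) (prefix S i) λ m p →
  trans (prefix-Agree T i m p) (trans (T≈S m p) (sym (prefix-Agree S i m p)))

window : ∀ {k} → Vec Bool k → ℕ → RMT
window x m = rmt (prev x m) (nth x m) (nth x (suc m))

prev-cong : ∀ {a b k} {T : Vec Bool a} {U : Vec Bool b}
  → Agree k T U → ∀ m → m ≤ k → prev T m ≡ prev U m
prev-cong T≈U zero    _ = refl
prev-cong T≈U (suc m) p = T≈U m p

window-cong : ∀ {a b k} {T : Vec Bool a} {U : Vec Bool b} → Agree k T U → ∀ m → suc m < k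
  → window T m ≡ window U m
window-cong {T = T} T≈U m p = begin
  rmt (prev T m) (nth T m) (nth T (suc m))
    ≡⟨ cong₂ (λ u v → rmt u v (nth T (suc m))) (prev-cong T≈U m (<⇒≤ m<k)) (T≈U m m<k) ⟩
  rmt _ _ (nth T (suc m))
    ≡⟨ cong (rmt _ _) (T≈U (suc m) p) ⟩
  _ ∎
  where
  open ≡-Reasoning
  m<k = <-trans (n<1+n m) p

nth-step : ∀ {n} (R : Fin n → Rule) (T : Vec Bool n) (j : Fin n)
  → nth (step R T) (toℕ j) ≡ R j (window T (toℕ j))
nth-step R T j = begin
  nth (step R T) (toℕ j)       ≡⟨ nth-lookup (step R T) j ⟩
  lookup (step R T) j          ≡⟨ lookup∘tabulate _ j ⟩
  R j (rmt x₋ (lookup T j) x₊) ≡⟨ cong (λ v → R j (rmt x₋ v x₊)) (nth-lookup T j) ⟨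
  R j (window T (toℕ j))       ∎
  where
  open ≡-Reasoning
  x₋ = prev T (toℕ j)
  x₊ = nth T (suc (toℕ j))

witness-step : ∀ {n} {R : Fin n → Rule} {i : Fin n} {b : Edge i} {x : Vec Bool (suc (suc (toℕ i)))}
  → IsWitness R i b x
  → (T : Vec Bool n) → Agree (suc (suc (toℕ i))) T x → Agree (suc (toℕ i)) (step R T) b
witness-step {R = R} {i} {b} {x} (rules , _) T T≈x = Agree-fromFin (step R T) b λ j →
  let j′ = inject≤ j (toℕ<n i) in begin
  nth (step R T) (toℕ j)   ≡⟨ cong (nth (step R T)) (toℕ-inject≤ j _) ⟨
  nth (step R T) (toℕ j′)  ≡⟨ nth-step R T j′ ⟩
  R j′ (window T (toℕ j′)) ≡⟨ cong (R j′ ∘ window T) (toℕ-inject≤ j _) ⟩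
  R j′ (window T (toℕ j))  ≡⟨ cong (R j′) (window-cong T≈x (toℕ j) (s≤s (toℕ<n j))) ⟩
  R j′ (window x (toℕ j))  ≡⟨ rules j ⟩
  lookup b j               ≡⟨ nth-lookup b j ⟨
  nth b (toℕ j)            ∎
  where open ≡-Reasoning

≢⇒covers : ∀ {a b : Bool} → a ≢ b → ∀ c → c ≡ a ⊎ c ≡ b
≢⇒covers {false} {false} a≢b _ = contradiction refl a≢b
≢⇒covers {true}  {true}  a≢b _ = contradiction refl a≢b
≢⇒covers {false} {true}  _ false = inj₁ refl
≢⇒covers {false} {true}  _ true  = inj₂ refl
≢⇒covers {true}  {false} _ false = inj₂ refl
≢⇒covers {true}  {false} _ true  = inj₁ refl

SelfWitness : ∀ {n} → (Fin n → Rule) → (i : Fin n) → Edge i → Bool → Set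
SelfWitness R i b c = Σ (Vec Bool (suc (suc (toℕ i)))) λ x →
  IsWitness R i b x × init x ≡ b × nth x (suc (toℕ i)) ≡ c

selfLinkedSiblings⇒selfWitness : ∀ {n} {R : Fin n → Rule} {i : Fin n} {b : Edge i}
  → SelfLinkedSiblings R i b → ∀ c → SelfWitness R i b c
selfLinkedSiblings⇒selfWitness {i = i}
  (r , r′ , (r≢r′ , _) , (x , w , refl , x↾) , (x′ , w′ , refl , x′↾)) c
  with ≢⇒covers last-bits-differ c
  where
  last-bits-differ : nth x (suc (toℕ i)) ≢ nth x′ (suc (toℕ i))
  last-bits-differ eq = r≢r′ (window-cong x≈x′ (toℕ i) (n<1+n _))
    where
    x≈x′ : Agree (suc (suc (toℕ i))) x x′
    x≈x′ = Agree-snoc x x′ (λ m p → trans (init≡⇒Agree x x↾ m p) (sym (init≡⇒Agree x′ x′↾ m p))) eq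
... | inj₁ c≡ = x  , w  , x↾  , sym c≡
... | inj₂ c≡ = x′ , w′ , x′↾ , sym c≡

step-preserves-prefix : ∀ {n} {R : Fin n → Rule} {S : Vec Bool n} {i : Fin n}
  → SelfLinkedSiblings R i (prefix S i)
  → (T : Vec Bool n) → prefix T i ≡ prefix S i → prefix (step R T) i ≡ prefix S i
step-preserves-prefix {R = R} {S} {i} sl T T↾
  with selfLinkedSiblings⇒selfWitness {R = R} {i} {prefix S i} sl (nth T (suc (toℕ i)))
... | x , w , x↾ , last = Agree⇒prefix≡ (step R T) S i λ m p →
  trans (witness-step {R = R} {i} {prefix S i} {x} w T T≈x m p) (prefix-Agree S i m p)
  where
  x≈S : Agree (suc (toℕ i)) x S
  x≈S m p = trans (init≡⇒Agree x x↾ m p) (prefix-Agree S i m p)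
  T≈x : Agree (suc (suc (toℕ i))) T x
  T≈x = Agree-snoc T x (λ m p → trans (prefix≡⇒Agree T S i T↾ m p) (sym (x≈S m p))) (sym last)

iterate-preserves : ∀ {A : Set} (P : A → Set) {f : A → A}
  → (∀ a → P a → P (f a)) → ∀ {a} → P a → ∀ t → P (iterate t f a)
iterate-preserves P pres Pa zero    = Pa
iterate-preserves P pres Pa (suc t) = pres _ (iterate-preserves P pres Pa t)

mainTheorem3 : (n : ℕ) → 2 ≤ n → (R : Fin n → Rule) → (S D : Vec Bool n) → (i : Fin n)
    → SelfLinkedSiblings R i (prefix S i) → prefix D i ≢ prefix S i → ¬ Reachable R S D
mainTheorem3 n _ R S D i sl D↾≢S↾ (t , _ , refl) =
  D↾≢S↾ (iterate-preserves (λ T → prefix T i ≡ prefix S i)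
                            (step-preserves-prefix {R = R} {S} sl) refl t)
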